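{- For every positive integer $n$: $\mathrm{Tr}(n)\not\to C_k$ for every integer $k\ge 5$; $\mathrm{Tr}(n)\not\to H^+$; and $\mathrm{Tr}(n)\not\to K_{2,3}$.
   Context: For graphs $G$ and $H$, write $G\to H$ if every 2-edge-coloring of $G$ (every map $E(G)\to\{0,1\}$) contains a monochromatic copy of $H$ (a subgraph isomorphic to $H$ all of whose edges have the same color), and $G\not\to H$ otherwise. $C_k$ denotes the cycle on $k$ vertices. The iterated triangulation $\mathrm{Tr}(n)$ is the plane graph defined recursively: $\mathrm{Tr}(0)\cong K_3$ is the plane triangle (a triangulation with two faces); for $i\ge 0$, $\mathrm{Tr}(i+1)$ is obtained from $\mathrm{Tr}(i)$ by placing a new vertex inside each inner face of $\mathrm{Tr}(i)$ and joining it by edges to the three vertices on the boundary of that face. $H^+$ is the bipartite graph obtained by adding one edge to the unique 6-vertex tree with 4 leaves and 2 vertices of degree three; concretely, $H^+$ consists of a 4-cycle $v_1v_2v_3v_4v_1$ together with two pendant edges $v_1v_5$ and $v_2v_6$ at adjacent vertices of the cycle. -}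

module Defs where

open import Data.Nat using (ℕ; zero; suc; _+_; _∸_; _≤_)
open import Data.Bool using (Bool)
open import Data.Fin using (Fin; toℕ)
open import Data.List using (List; []; _∷_; _++_; length; map; upTo)
open import Data.List.Membership.Propositional using (_∈_)
open import Data.Product using (Σ; _×_; _,_; ∃)
open import Data.Sum using (_⊎_)
open import Relation.Binary.PropositionalEquality using (_≡_)
open import Relation.Nullary using (¬_)
open import Function.Definitions using (Injective)

record Graph : Set₁ where
  field
    V   : Set
    Adj : V → V → Set
open Graph public

ListGraph : ℕ → List (ℕ × ℕ) → Graph
ListGraph n es = record
  { V   = Fin n
  ; Adj = λ u v → ((toℕ u , toℕ v) ∈ es) ⊎ ((toℕ v , toℕ u) ∈ es)
  }

-- A 2-edge-coloring of G is given by a symmetric map V × V → Bool;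
-- only its values on edges matter (every map E(G) → {0,1} arises this way).
SymColoring : Graph → Set
SymColoring G = Σ (V G → V G → Bool) λ c → ∀ u v → c u v ≡ c v u

MonoCopy : (G H : Graph) → (V G → V G → Bool) → Set
MonoCopy G H c =
  Σ Bool λ b → Σ (V H → V G) λ φ →
    Injective _≡_ _≡_ φ ×
    (∀ u v → Adj H u v → Adj G (φ u) (φ v) × c (φ u) (φ v) ≡ b)

Arrows : Graph → Graph → Set
Arrows G H = (c : SymColoring G) → MonoCopy G H (Σ.proj₁ c)
  where open Data.Product

NotArrows : Graph → Graph → Set
NotArrows G H = ¬ Arrows G H

cycleEdges : ℕ → List (ℕ × ℕ)
cycleEdges k = (k ∸ 1 , 0) ∷ map (λ i → i , suc i) (upTo (k ∸ 1))

Cycle : ℕ → Graph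
Cycle k = ListGraph k (cycleEdges k)

-- H⁺: 4-cycle v1v2v3v4 (here 0,1,2,3) plus pendant edges v1v5 (0-4), v2v6 (1-5).
Hplus : Graph
Hplus = ListGraph 6
  ((0 , 1) ∷ (1 , 2) ∷ (2 , 3) ∷ (3 , 0) ∷ (0 , 4) ∷ (1 , 5) ∷ [])

K23 : Graph
K23 = ListGraph 5
  ((0 , 2) ∷ (0 , 3) ∷ (0 , 4) ∷ (1 , 2) ∷ (1 , 3) ∷ (1 , 4) ∷ [])

record TrData : Set where
  field
    nv : ℕ
    es : List (ℕ × ℕ)
    fs : List (ℕ × ℕ × ℕ)         -- inner faces (boundary triangles)
open TrData public

subdivide : ℕ → List (ℕ × ℕ × ℕ) → List (ℕ × ℕ) × List (ℕ × ℕ × ℕ)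
subdivide N [] = [] , []
subdivide N ((x , y , z) ∷ rest) with subdivide (suc N) rest
... | e , f = ((x , N) ∷ (y , N) ∷ (z , N) ∷ e)
            , ((x , y , N) ∷ (y , z , N) ∷ (x , z , N) ∷ f)

trData : ℕ → TrData
trData zero = record
  { nv = 3 ; es = (0 , 1) ∷ (1 , 2) ∷ (0 , 2) ∷ [] ; fs = (0 , 1 , 2) ∷ [] }
trData (suc i) with trData i
... | T with subdivide (nv T) (fs T)
...   | e , f = record { nv = nv T + length (fs T) ; es = es T ++ e ; fs = f }

Tr : ℕ → Graph
Tr n = ListGraph (nv (trData n)) (es (trData n))

-- Number the vertices of Tr(n) in order of insertion: every vertex v ≥ 3 then has exactly three
-- lower neighbours, the corners of the face it was inserted into, and any two of them are adjacent.
--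
-- For C_k and H⁺, label the vertices so that every face is non-monochromatic, a new vertex taking
-- the label that occurs only once on its face, and colour each edge by the label of its lower end.
-- Then a vertex has at most one lower neighbour with its own label and at most two with the other
-- label, and all b-coloured edges at a vertex of label ≠ b go down. On a walk of colour b, take the
-- highest vertex m of label b: two steps in either direction lead to the unique lower neighbour of
-- m with the label of m, so a b-cycle through m has length 4 and both cycle neighbours of m have
-- label ≠ b. This rules out C_k for k ≥ 5, and in H⁺ one of these neighbours also carries a
-- pendant edge, giving it three b-neighbours.
--
-- For K_{2,3}, give a new vertex the negated label of the youngest corner of its face (its parent).
-- Colour the edges from v down to its parent and to one further "special" corner with the label of
-- v, and the third edge down with the other colour; the three faces created by inserting a vertex
-- get three different special corners. For x < y, a common neighbour z of one colour is then
-- either below y or the unique vertex with parent y and special corner x. Three lower neighbours of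
-- y never share a colour, two of them do only in the colour given by the label of y, and a vertex
-- with parent y has the opposite label.

module Submission where

open import Defs
open import Data.Bool using (Bool; true; false; not; _xor_; _∧_; if_then_else_)
open import Data.Bool.Properties using (not-¬) renaming (_≟_ to _≟ᵇ_)
open import Data.Empty using (⊥; ⊥-elim)
open import Data.Fin as Fin using (Fin; toℕ; #_)
open import Data.Fin.Properties using (toℕ-injective; toℕ-fromℕ<; toℕ<n)
open import Data.List using (List; []; _∷_; _++_; length; map; filter; upTo)
open import Data.List.Properties using (length-++; length-map)
open import Data.List.Membership.Propositional using (_∈_)
open import Data.List.Membership.Propositional.Properties
  using (∈-++⁺ˡ; ∈-++⁺ʳ; ∈-++⁻; ∈-filter⁺; ∈-filter⁻; ∈-map⁺; ∈-upTo⁺; ∈-allFin)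
open import Data.List.Relation.Unary.All as All using (All)
open import Data.List.Relation.Unary.AllPairs using ([]; _∷_)
open import Data.List.Relation.Unary.Any using (here; there)
open import Data.List.Relation.Unary.Unique.Propositional using (Unique)
import Data.List.Relation.Unary.Unique.Propositional.Properties as Unique
open import Data.Nat
open import Data.Nat.DivMod
  using (_%_; _mod_; %-distribˡ-+; m%n%n≡m%n; m<n⇒m%n≡m; m%n<n; n%n≡0; m≤n⇒[n∸m]%m≡n%m; [m+n]%n≡m%n)
open import Data.Nat.Properties
open import Data.List.Extrema ≤-totalOrder using (argmax; argmax-sel; f[xs]≤f[argmax])
open import Data.Product using (∃-syntax; _×_; _,_; proj₁; proj₂)
open import Data.Sum using (_⊎_; inj₁; inj₂; swap)
open import Function using (_∘_; case_of_)
open import Function.Definitions using (Injective)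
open import Relation.Binary.Definitions using (tri<; tri≈; tri>)
open import Relation.Binary.PropositionalEquality
open import Relation.Nullary using (¬_; yes; no; does; Dec)
open import Relation.Nullary.Decidable using (dec-true; dec-false; _×-dec_; _⊎-dec_; False; toWitnessFalse)
open import Relation.Unary using (Decidable)

lookupOr : {A : Set} → A → List A → ℕ → A
lookupOr d []       _       = d
lookupOr d (x ∷ xs) zero    = x
lookupOr d (x ∷ xs) (suc i) = lookupOr d xs i

module _ {A : Set} (d : A) where

  lookupOr-++ˡ : ∀ xs ys {i} → i < length xs → lookupOr d (xs ++ ys) i ≡ lookupOr d xs i
  lookupOr-++ˡ (x ∷ xs) ys {zero}  _         = refl
  lookupOr-++ˡ (x ∷ xs) ys {suc i} (s≤s i<) = lookupOr-++ˡ xs ys i<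

  lookupOr-++ʳ : ∀ xs ys j → lookupOr d (xs ++ ys) (length xs + j) ≡ lookupOr d ys j
  lookupOr-++ʳ []       ys j = refl
  lookupOr-++ʳ (x ∷ xs) ys j = lookupOr-++ʳ xs ys j

  lookupOr-∈ : ∀ xs {i} → i < length xs → lookupOr d xs i ∈ xs
  lookupOr-∈ (x ∷ xs) {zero}  _        = here refl
  lookupOr-∈ (x ∷ xs) {suc i} (s≤s i<) = there (lookupOr-∈ xs i<)

  lookupOr-map : ∀ {B : Set} (d′ : B) (f : A → B) xs {i} → i < length xs →
                 lookupOr d′ (map f xs) i ≡ f (lookupOr d xs i)
  lookupOr-map d′ f (x ∷ xs) {zero}  _        = refl
  lookupOr-map d′ f (x ∷ xs) {suc i} (s≤s i<) = lookupOr-map d′ f xs i<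

  lookupOr-injective : ∀ {xs} → Unique xs → ∀ {i j} → i < length xs → j < length xs →
                       lookupOr d xs i ≡ lookupOr d xs j → i ≡ j
  lookupOr-injective (x∉ ∷ u) {zero}  {zero}  _        _        _ = refl
  lookupOr-injective {x ∷ xs} (x∉ ∷ u) {zero}  {suc j} _ (s≤s j<) e =
    ⊥-elim (All.lookup x∉ (lookupOr-∈ xs j<) e)
  lookupOr-injective {x ∷ xs} (x∉ ∷ u) {suc i} {zero}  (s≤s i<) _ e =
    ⊥-elim (All.lookup x∉ (lookupOr-∈ xs i<) (sym e))
  lookupOr-injective (x∉ ∷ u) {suc i} {suc j} (s≤s i<) (s≤s j<) e =
    cong suc (lookupOr-injective u i< j< e)

AtMostOne : (ℕ → Set) → Set
AtMostOne P = ∀ {x y} → P x → P y → x ≡ y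

AtMostTwo : (ℕ → Set) → Set
AtMostTwo P = ∀ {x y z} → P x → P y → P z → x ≡ y ⊎ x ≡ z ⊎ y ≡ z

atMostTwo-⊆ : ∀ {P Q : ℕ → Set} → (∀ {x} → P x → Q x) → AtMostTwo Q → AtMostTwo P
atMostTwo-⊆ P⊆Q atMostTwo px py pz = atMostTwo (P⊆Q px) (P⊆Q py) (P⊆Q pz)

atMostTwo-pair : ∀ a b → AtMostTwo (λ x → x ≡ a ⊎ x ≡ b)
atMostTwo-pair a b (inj₁ refl) (inj₁ refl) _           = inj₁ refl
atMostTwo-pair a b (inj₂ refl) (inj₂ refl) _           = inj₁ refl
atMostTwo-pair a b (inj₁ refl) (inj₂ refl) (inj₁ refl) = inj₂ (inj₁ refl)
atMostTwo-pair a b (inj₁ refl) (inj₂ refl) (inj₂ refl) = inj₂ (inj₂ refl)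
atMostTwo-pair a b (inj₂ refl) (inj₁ refl) (inj₁ refl) = inj₂ (inj₂ refl)
atMostTwo-pair a b (inj₂ refl) (inj₁ refl) (inj₂ refl) = inj₂ (inj₁ refl)

atMostTwo-distinct : ∀ {P : ℕ → Set} {x y z} → AtMostTwo P → P x → P y → P z →
                     x ≢ y → x ≢ z → y ≢ z → ⊥
atMostTwo-distinct atMostTwo px py pz x≢y x≢z y≢z with atMostTwo px py pz
... | inj₁ x≡y        = x≢y x≡y
... | inj₂ (inj₁ x≡z) = x≢z x≡z
... | inj₂ (inj₂ y≡z) = y≢z y≡z

atMostOne-pair-≢ : ∀ {a b m} → m ≡ a ⊎ m ≡ b → AtMostOne (λ x → (x ≡ a ⊎ x ≡ b) × x ≢ m)
atMostOne-pair-≢ (inj₁ refl) (inj₁ refl , x≢m) _                = ⊥-elim (x≢m refl)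
atMostOne-pair-≢ (inj₁ refl) (inj₂ refl , _)   (inj₁ refl , y≢m) = ⊥-elim (y≢m refl)
atMostOne-pair-≢ (inj₁ refl) (inj₂ refl , _)   (inj₂ refl , _)   = refl
atMostOne-pair-≢ (inj₂ refl) (inj₂ refl , x≢m) _                = ⊥-elim (x≢m refl)
atMostOne-pair-≢ (inj₂ refl) (inj₁ refl , _)   (inj₂ refl , y≢m) = ⊥-elim (y≢m refl)
atMostOne-pair-≢ (inj₂ refl) (inj₁ refl , _)   (inj₁ refl , _)   = refl

injective-≢ : ∀ {k} {ψ : Fin k → ℕ} → Injective _≡_ _≡_ ψ → ∀ i j {i≢j : False (i Fin.≟ j)} → ψ i ≢ ψ j
injective-≢ ψ-injective i j {i≢j} = toWitnessFalse i≢j ∘ ψ-injective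

argmax-∈ : ∀ {A : Set} (f : A → ℕ) {P : A → Set} → Decidable P → ∀ {xs i} → i ∈ xs → P i →
           ∃[ m ] m ∈ xs × P m × ∀ {j} → j ∈ xs → P j → f j ≤ f m
argmax-∈ {A} f {P} P? {xs} {i} i∈ pi =
  let (m∈ , pm) = m∈×pm (argmax-sel f i (filter P? xs)) in m , m∈ , pm , bound
  where
  m : A
  m = argmax f i (filter P? xs)
  m∈×pm : m ≡ i ⊎ m ∈ filter P? xs → m ∈ xs × P m
  m∈×pm (inj₁ m≡i) = subst (_∈ xs) (sym m≡i) i∈ , subst P (sym m≡i) pi
  m∈×pm (inj₂ m∈)   = ∈-filter⁻ P? m∈
  bound : ∀ {j} → j ∈ xs → P j → f j ≤ f m
  bound j∈ pj = All.lookup (f[xs]≤f[argmax] i (filter P? xs)) (∈-filter⁺ P? j∈ pj)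

cycle-mod-adjacent : ∀ K t → Adj (Cycle (suc K)) (t mod suc K) (suc t mod suc K)
cycle-mod-adjacent K t =
  inj₁ (subst₂ (λ a b → (a , b) ∈ cycleEdges (suc K)) (sym (toℕ-fromℕ< _)) (sym (toℕ-fromℕ< _)) consecutive)
  where
  r : ℕ
  r = t % suc K
  suc-mod : suc t % suc K ≡ suc r % suc K
  suc-mod = begin
    (1 + t) % suc K                          ≡⟨ %-distribˡ-+ 1 t (suc K) ⟩
    (1 % suc K + r) % suc K                  ≡⟨ cong (λ x → (1 % suc K + x) % suc K) (m%n%n≡m%n t (suc K)) ⟨
    (1 % suc K + r % suc K) % suc K          ≡⟨ %-distribˡ-+ 1 r (suc K) ⟨
    (1 + r) % suc K                          ∎
    where open ≡-Reasoning
  consecutive : (r , suc t % suc K) ∈ cycleEdges (suc K)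
  consecutive with suc r <? suc K
  ... | yes 1+r<k = there (subst (λ s → (r , s) ∈ map (λ i → i , suc i) (upTo K))
                                  (sym (trans suc-mod (m<n⇒m%n≡m 1+r<k)))
                                  (∈-map⁺ (λ i → i , suc i) (∈-upTo⁺ (s≤s⁻¹ 1+r<k))))
  ... | no 1+r≮k = subst₂ (λ a b → (a , b) ∈ cycleEdges (suc K)) (sym r≡K) (sym wraps) (here refl)
    where
    r≡K : r ≡ K
    r≡K = ≤-antisym (s≤s⁻¹ (m%n<n t (suc K))) (s≤s⁻¹ (≮⇒≥ 1+r≮k))
    wraps : suc t % suc K ≡ 0
    wraps = trans suc-mod (trans (cong (λ x → suc x % suc K) r≡K) (n%n≡0 (suc K)))

toℕ+k-mod : ∀ {k} .{{_ : NonZero k}} (i : Fin k) → (toℕ i + k) mod k ≡ i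
toℕ+k-mod {k} i = toℕ-injective (begin
  toℕ ((toℕ i + k) mod k)  ≡⟨ toℕ-fromℕ< _ ⟩
  (toℕ i + k) % k          ≡⟨ [m+n]%n≡m%n (toℕ i) k ⟩
  toℕ i % k                ≡⟨ m<n⇒m%n≡m (toℕ<n i) ⟩
  toℕ i                    ∎)
  where open ≡-Reasoning

shift-mod-≢ : ∀ {k q d} .{{_ : NonZero k}} → 0 < d → d < k → q < k → (d + q) % k ≢ q
shift-mod-≢ {k} {q} {d} 0<d d<k q<k with d + q <? k
... | yes d+q<k = λ same → <⇒≢ (m<n+m q 0<d) (sym (trans (sym (m<n⇒m%n≡m d+q<k)) same))
... | no d+q≮k = λ same → <⇒≢ wrapped< (trans (sym wrapped) same)
  where
  k≤d+q : k ≤ d + q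
  k≤d+q = ≮⇒≥ d+q≮k
  wrapped< : d + q ∸ k < q
  wrapped< = subst (d + q ∸ k <_) (m+n∸m≡n k q) (∸-monoˡ-< (+-monoˡ-< q d<k) k≤d+q)
  wrapped : (d + q) % k ≡ d + q ∸ k
  wrapped = trans (sym (m≤n⇒[n∸m]%m≡n%m k≤d+q)) (m<n⇒m%n≡m (<-trans wrapped< q<k))

mod-shift-≢ : ∀ {k} .{{_ : NonZero k}} r {d} → 0 < d → d < k → r mod k ≢ (d + r) mod k
mod-shift-≢ {k} r {d} 0<d d<k same = shift-mod-≢ 0<d d<k (m%n<n r k) (sym (begin
  r % k               ≡⟨ toℕ-fromℕ< _ ⟨
  toℕ (r mod k)       ≡⟨ cong toℕ same ⟩
  toℕ ((d + r) mod k) ≡⟨ toℕ-fromℕ< _ ⟩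
  (d + r) % k         ≡⟨ %-distribˡ-+ d r k ⟩
  (d % k + r % k) % k ≡⟨ cong (λ x → (x + r % k) % k) (m<n⇒m%n≡m d<k) ⟩
  (d + r % k) % k     ∎))
  where open ≡-Reasoning

-- Faces and their subdivision

Triple : Set
Triple = ℕ × ℕ × ℕ

defaultTriple : Triple
defaultTriple = 0 , 0 , 0

apex : Triple → ℕ
apex (_ , _ , c) = c

_∈▵_ : ℕ → Triple → Set
x ∈▵ (a , b , c) = x ≡ a ⊎ x ≡ b ⊎ x ≡ c

Ascending : Triple → Set
Ascending (a , b , c) = a < b × b < c

children : Triple → ℕ → List Triple
children (a , b , c) w = (a , b , w) ∷ (b , c , w) ∷ (a , c , w) ∷ []

∈-subdivide-edges⁻ : ∀ N F {a b} → (a , b) ∈ proj₁ (subdivide N F) →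
  ∃[ j ] j < length F × b ≡ N + j × a ∈▵ lookupOr defaultTriple F j
∈-subdivide-edges⁻ N (t ∷ F) (here refl)                 = 0 , z<s , sym (+-identityʳ N) , inj₁ refl
∈-subdivide-edges⁻ N (t ∷ F) (there (here refl))         = 0 , z<s , sym (+-identityʳ N) , inj₂ (inj₁ refl)
∈-subdivide-edges⁻ N (t ∷ F) (there (there (here refl))) = 0 , z<s , sym (+-identityʳ N) , inj₂ (inj₂ refl)
∈-subdivide-edges⁻ N (t ∷ F) (there (there (there e∈))) with ∈-subdivide-edges⁻ (suc N) F e∈
... | j , j< , refl , a∈ = suc j , s<s j< , sym (+-suc N j) , a∈

subdivide-edges⁺ : ∀ N F {j x} → j < length F → x ∈▵ lookupOr defaultTriple F j →
  (x , N + j) ∈ proj₁ (subdivide N F)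
subdivide-edges⁺ N (t ∷ F) {zero} _ x∈ rewrite +-identityʳ N with x∈
... | inj₁ refl        = here refl
... | inj₂ (inj₁ refl) = there (here refl)
... | inj₂ (inj₂ refl) = there (there (here refl))
subdivide-edges⁺ N (t ∷ F) {suc j} (s≤s j<) x∈ rewrite +-suc N j =
  there (there (there (subdivide-edges⁺ (suc N) F j< x∈)))

∈-subdivide-faces⁻ : ∀ N F {s} → s ∈ proj₂ (subdivide N F) →
  ∃[ j ] j < length F × s ∈ children (lookupOr defaultTriple F j) (N + j)
∈-subdivide-faces⁻ N (t ∷ F) {s} s∈ with ∈-++⁻ (children t N) s∈
... | inj₁ s∈t = 0 , z<s , subst (λ w → s ∈ children t w) (sym (+-identityʳ N)) s∈t
... | inj₂ s∈F with ∈-subdivide-faces⁻ (suc N) F s∈F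
...   | j , j< , s∈c = suc j , s<s j< , subst (λ w → s ∈ children (lookupOr defaultTriple F j) w) (sym (+-suc N j)) s∈c

apex-children : ∀ t w {s} → s ∈ children t w → apex s ≡ w
apex-children t w (here refl)                 = refl
apex-children t w (there (here refl))         = refl
apex-children t w (there (there (here refl))) = refl

subdivide-faces-apex : ∀ N F {s} → s ∈ proj₂ (subdivide N F) → N ≤ apex s
subdivide-faces-apex N F s∈ with ∈-subdivide-faces⁻ N F s∈
... | j , _ , s∈c = subst (N ≤_) (sym (apex-children _ _ s∈c)) (m≤m+n N j)

subdivide-faces-unique : ∀ N F → All Ascending F → Unique (proj₂ (subdivide N F))
subdivide-faces-unique N [] All.[] = []
subdivide-faces-unique N ((a , b , c) ∷ F) ((a<b , b<c) All.∷ asc) =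
  (≢₁ All.∷ ≢₂ All.∷ new (a , b)) ∷ (≢₃ All.∷ new (b , c)) ∷ new (a , c) ∷ rest
  where
  rest : Unique (proj₂ (subdivide (suc N) F))
  rest = subdivide-faces-unique (suc N) F asc
  new : ∀ (p : ℕ × ℕ) → All ((proj₁ p , proj₂ p , N) ≢_) (proj₂ (subdivide (suc N) F))
  new p = All.tabulate (λ s∈ e → 1+n≰n (subst (λ s → suc N ≤ apex s) (sym e) (subdivide-faces-apex (suc N) F s∈)))
  ≢₁ : (a , b , N) ≢ (b , c , N)
  ≢₁ e = <⇒≢ a<b (cong proj₁ e)
  ≢₂ : (a , b , N) ≢ (a , c , N)
  ≢₂ e = <⇒≢ b<c (cong (proj₁ ∘ proj₂) e)
  ≢₃ : (b , c , N) ≢ (a , c , N)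
  ≢₃ e = <⇒≢ a<b (sym (cong proj₁ e))

∈▵-≢apex : ∀ {x} t → x ∈▵ t → x ≢ apex t → x ≡ proj₁ t ⊎ x ≡ proj₁ (proj₂ t)
∈▵-≢apex t (inj₁ x≡a)        _      = inj₁ x≡a
∈▵-≢apex t (inj₂ (inj₁ x≡b)) _      = inj₂ x≡b
∈▵-≢apex t (inj₂ (inj₂ x≡c)) x≢apex = ⊥-elim (x≢apex x≡c)

∈▵-others : ∀ {m} t → m ∈▵ t → ∃[ u ] ∃[ w ] ∀ {x} → x ∈▵ t → x ≢ m → x ≡ u ⊎ x ≡ w
∈▵-others (a , b , c) (inj₁ refl) = b , c , λ
  { (inj₁ refl) x≢m → ⊥-elim (x≢m refl) ; (inj₂ x∈) _ → x∈ }
∈▵-others (a , b , c) (inj₂ (inj₁ refl)) = a , c , λ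
  { (inj₁ x≡a) _ → inj₁ x≡a ; (inj₂ (inj₁ refl)) x≢m → ⊥-elim (x≢m refl) ; (inj₂ (inj₂ x≡c)) _ → inj₂ x≡c }
∈▵-others (a , b , c) (inj₂ (inj₂ refl)) = a , b , λ
  { (inj₁ x≡a) _ → inj₁ x≡a ; (inj₂ (inj₁ x≡b)) _ → inj₂ x≡b ; (inj₂ (inj₂ refl)) x≢m → ⊥-elim (x≢m refl) }

atMostTwo-∈▵-≢ : ∀ {m} t → m ∈▵ t → AtMostTwo (λ x → x ∈▵ t × x ≢ m)
atMostTwo-∈▵-≢ t m∈ with ∈▵-others t m∈
... | u , w , others = atMostTwo-⊆ (λ (x∈ , x≢m) → others x∈ x≢m) (atMostTwo-pair u w)

-- The structure of Tr(n)

N : ℕ → ℕ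
N n = nv (trData n)

E : ℕ → List (ℕ × ℕ)
E n = es (trData n)

F : ℕ → List Triple
F n = fs (trData n)

insertionFaces : ℕ → List Triple
insertionFaces zero    = []
insertionFaces (suc n) = insertionFaces n ++ F n

-- Vertex 3 + i was inserted into the i-th face of insertionFaces n; for v < 3 the value is junk.
parentFace : ℕ → ℕ → Triple
parentFace n v = lookupOr defaultTriple (insertionFaces n) (v ∸ 3)

IsTriangle : ℕ → Triple → Set
IsTriangle n (a , b , c) =
  a < b × b < c × c < N n × (a , b) ∈ E n × (b , c) ∈ E n × (a , c) ∈ E n

IsChild : ℕ → Triple → Set
IsChild n t = t ≡ (0 , 1 , 2) ⊎ (3 ≤ apex t × t ∈ children (parentFace n (apex t)) (apex t))

EdgeShape : ℕ → ℕ → ℕ → Set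
EdgeShape n a b = (b ≤ 2 × (a ≡ 0 ⊎ a ≡ 1)) ⊎ (3 ≤ b × a ∈▵ parentFace n b)

record Invariant (n : ℕ) : Set where
  field
    insertionFaces-length : length (insertionFaces n) + 3 ≡ N n
    edge-shape      : ∀ {a b} → (a , b) ∈ E n → a < b × b < N n × EdgeShape n a b
    face-shape      : ∀ {t} → t ∈ insertionFaces n ++ F n → IsTriangle n t × IsChild n t
    apex-parentFace : ∀ {v} → 3 ≤ v → v < N n → apex (parentFace n v) < v
    faces-unique    : Unique (insertionFaces n ++ F n)

invariant-zero : Invariant 0
invariant-zero = record
  { insertionFaces-length = refl
  ; edge-shape      = shape
  ; face-shape      = λ { (here refl) → outer , inj₁ refl }
  ; apex-parentFace = λ 3≤v v<3 → ⊥-elim (<⇒≱ v<3 3≤v)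
  ; faces-unique    = All.[] ∷ []
  }
  where
  outer : IsTriangle 0 (0 , 1 , 2)
  outer = z<s , s<s z<s , s<s (s<s z<s) , here refl , there (here refl) , there (there (here refl))
  shape : ∀ {a b} → (a , b) ∈ E 0 → a < b × b < N 0 × EdgeShape 0 a b
  shape (here refl)                 = z<s , s<s z<s , inj₁ (s≤s z≤n , inj₁ refl)
  shape (there (here refl))         = s<s z<s , s<s (s<s z<s) , inj₁ (≤-refl , inj₂ refl)
  shape (there (there (here refl))) = z<s , s<s (s<s z<s) , inj₁ (≤-refl , inj₁ refl)

N-mono : ∀ n → N n ≤ N (suc n)
N-mono n = m≤m+n (N n) (length (F n))

3≤N : ∀ n → 3 ≤ N n
3≤N zero    = ≤-refl
3≤N (suc n) = ≤-trans (3≤N n) (N-mono n)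

module Shape {n : ℕ} (I : Invariant n) where
  open Invariant I public

  apex< : ∀ {t} → IsTriangle n t → apex t < N n
  apex< (_ , _ , c<N , _) = c<N

  ∈▵-< : ∀ {t x} → IsTriangle n t → x ∈▵ t → x < N n
  ∈▵-< (a<b , b<c , c<N , _) (inj₁ refl)        = <-trans a<b (<-trans b<c c<N)
  ∈▵-< (a<b , b<c , c<N , _) (inj₂ (inj₁ refl)) = <-trans b<c c<N
  ∈▵-< (a<b , b<c , c<N , _) (inj₂ (inj₂ refl)) = c<N

  index< : ∀ {v} → 3 ≤ v → v < N n → v ∸ 3 < length (insertionFaces n)
  index< {v} 3≤v v<N = +-cancelʳ-< 3 (v ∸ 3) _
    (subst₂ _<_ (sym (m∸n+n≡m 3≤v)) (sym insertionFaces-length) v<N)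

  parentFace-∈ : ∀ {v} → 3 ≤ v → v < N n → parentFace n v ∈ insertionFaces n ++ F n
  parentFace-∈ 3≤v v<N = ∈-++⁺ˡ (lookupOr-∈ defaultTriple (insertionFaces n) (index< 3≤v v<N))

  parentFace-shape : ∀ {v} → 3 ≤ v → v < N n → IsTriangle n (parentFace n v) × IsChild n (parentFace n v)
  parentFace-shape 3≤v v<N = face-shape (parentFace-∈ 3≤v v<N)

  parentFace-injective : ∀ {v v′} → 3 ≤ v → v < N n → 3 ≤ v′ → v′ < N n →
                         parentFace n v ≡ parentFace n v′ → v ≡ v′
  parentFace-injective {v} {v′} 3≤v v<N 3≤v′ v′<N same = begin
    v           ≡⟨ m∸n+n≡m 3≤v ⟨
    v ∸ 3 + 3   ≡⟨ cong (_+ 3) index≡ ⟩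
    v′ ∸ 3 + 3  ≡⟨ m∸n+n≡m 3≤v′ ⟩
    v′          ∎
    where
    open ≡-Reasoning
    AF : List Triple
    AF = insertionFaces n
    i< : v ∸ 3 < length AF
    i< = index< 3≤v v<N
    i′< : v′ ∸ 3 < length AF
    i′< = index< 3≤v′ v′<N
    <length : ∀ {i} → i < length AF → i < length (AF ++ F n)
    <length i< = <-≤-trans i< (subst (length AF ≤_) (sym (length-++ AF)) (m≤m+n _ _))
    index≡ : v ∸ 3 ≡ v′ ∸ 3
    index≡ = lookupOr-injective defaultTriple faces-unique (<length i<) (<length i′<)
      (trans (lookupOr-++ˡ defaultTriple AF (F n) i<)
        (trans same (sym (lookupOr-++ˡ defaultTriple AF (F n) i′<))))

module Step (n : ℕ) (I : Invariant n) where
  open Shape I public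

  new-vertex : ∀ {v} → N n ≤ v → v < N (suc n) → ∃[ j ] j < length (F n) × N n + j ≡ v
  new-vertex N≤v v<N′ =
    _ , +-cancelˡ-< (N n) _ _ (subst (_< N (suc n)) (sym (m+[n∸m]≡n N≤v)) v<N′) , m+[n∸m]≡n N≤v

  parentFace-stable : ∀ {v} → 3 ≤ v → v < N n → parentFace (suc n) v ≡ parentFace n v
  parentFace-stable 3≤v v<N = lookupOr-++ˡ defaultTriple (insertionFaces n) (F n) (index< 3≤v v<N)

  parentFace-new : ∀ j → parentFace (suc n) (N n + j) ≡ lookupOr defaultTriple (F n) j
  parentFace-new j = trans (cong (lookupOr defaultTriple (insertionFaces (suc n))) index)
                           (lookupOr-++ʳ defaultTriple (insertionFaces n) (F n) j)
    where
    index : N n + j ∸ 3 ≡ length (insertionFaces n) + j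
    index = trans (+-∸-comm j (3≤N n))
                  (cong (_+ j) (trans (cong (_∸ 3) (sym insertionFaces-length)) (m+n∸n≡m _ 3)))

  E-old : ∀ {e} → e ∈ E n → e ∈ E (suc n)
  E-old = ∈-++⁺ˡ

  E-new : ∀ {e} → e ∈ proj₁ (subdivide (N n) (F n)) → e ∈ E (suc n)
  E-new = ∈-++⁺ʳ (E n)

  new< : ∀ {j} → j < length (F n) → N n + j < N (suc n)
  new< j< = +-monoʳ-< (N n) j<

  isTriangle-stable : ∀ {t} → IsTriangle n t → IsTriangle (suc n) t
  isTriangle-stable (a<b , b<c , c<N , ab , bc , ac) =
    a<b , b<c , <-≤-trans c<N (N-mono n) , E-old ab , E-old bc , E-old ac

  isChild-stable : ∀ {t} → apex t < N n → IsChild n t → IsChild (suc n) t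
  isChild-stable c<N (inj₁ t≡)         = inj₁ t≡
  isChild-stable c<N (inj₂ (3≤c , t∈)) =
    inj₂ (3≤c , subst (λ p → _ ∈ children p _) (sym (parentFace-stable 3≤c c<N)) t∈)

  F-isTriangle : ∀ {j} → j < length (F n) → IsTriangle n (lookupOr defaultTriple (F n) j)
  F-isTriangle j< = proj₁ (face-shape (∈-++⁺ʳ (insertionFaces n) (lookupOr-∈ defaultTriple (F n) j<)))

  child-isTriangle : ∀ {t w s} → IsTriangle n t → N n ≤ w → w < N (suc n) →
                     (∀ {x} → x ∈▵ t → (x , w) ∈ E (suc n)) → s ∈ children t w → IsTriangle (suc n) s
  child-isTriangle (a<b , b<c , c<N , ab , bc , ac) N≤w w<N′ new (here refl) =
    a<b , <-≤-trans (<-trans b<c c<N) N≤w , w<N′ , E-old ab , new (inj₂ (inj₁ refl)) , new (inj₁ refl)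
  child-isTriangle (a<b , b<c , c<N , ab , bc , ac) N≤w w<N′ new (there (here refl)) =
    b<c , <-≤-trans c<N N≤w , w<N′ , E-old bc , new (inj₂ (inj₂ refl)) , new (inj₂ (inj₁ refl))
  child-isTriangle (a<b , b<c , c<N , ab , bc , ac) N≤w w<N′ new (there (there (here refl))) =
    <-trans a<b b<c , <-≤-trans c<N N≤w , w<N′ , E-old ac , new (inj₂ (inj₂ refl)) , new (inj₁ refl)

  new-face-shape : ∀ {s} → s ∈ F (suc n) → IsTriangle (suc n) s × IsChild (suc n) s
  new-face-shape {s} s∈ with ∈-subdivide-faces⁻ (N n) (F n) s∈
  ... | j , j< , s∈c =
    child-isTriangle (F-isTriangle j<) (m≤m+n (N n) j) (new< j<)
      (λ x∈ → E-new (subdivide-edges⁺ (N n) (F n) j< x∈)) s∈c ,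
    inj₂ (subst (3 ≤_) (sym apex≡) (≤-trans (3≤N n) (m≤m+n (N n) j)) ,
          subst (λ w → s ∈ children (parentFace (suc n) w) w) (sym apex≡)
            (subst (λ p → s ∈ children p (N n + j)) (sym (parentFace-new j)) s∈c))
    where
    apex≡ : apex s ≡ N n + j
    apex≡ = apex-children _ _ s∈c

  edge-shape′ : ∀ {a b} → (a , b) ∈ E (suc n) → a < b × b < N (suc n) × EdgeShape (suc n) a b
  edge-shape′ e∈ with ∈-++⁻ (E n) e∈
  ... | inj₁ old with edge-shape old
  ...   | a<b , b<N , inj₁ initial    = a<b , <-≤-trans b<N (N-mono n) , inj₁ initial
  ...   | a<b , b<N , inj₂ (3≤b , a∈) =
    a<b , <-≤-trans b<N (N-mono n) , inj₂ (3≤b , subst (_ ∈▵_) (sym (parentFace-stable 3≤b b<N)) a∈)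
  edge-shape′ e∈ | inj₂ new with ∈-subdivide-edges⁻ (N n) (F n) new
  ... | j , j< , refl , a∈ =
    <-≤-trans (∈▵-< (F-isTriangle j<) a∈) (m≤m+n (N n) j) , new< j< ,
    inj₂ (≤-trans (3≤N n) (m≤m+n (N n) j) , subst (_ ∈▵_) (sym (parentFace-new j)) a∈)

  face-shape′ : ∀ {t} → t ∈ insertionFaces (suc n) ++ F (suc n) → IsTriangle (suc n) t × IsChild (suc n) t
  face-shape′ t∈ with ∈-++⁻ (insertionFaces n ++ F n) t∈
  ... | inj₁ old = let (tri , child) = face-shape old in
                   isTriangle-stable tri , isChild-stable (apex< tri) child
  ... | inj₂ new = new-face-shape new

  apex-parentFace′ : ∀ {v} → 3 ≤ v → v < N (suc n) → apex (parentFace (suc n) v) < v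
  apex-parentFace′ {v} 3≤v v<N′ with v <? N n
  ... | yes v<N = subst (λ p → apex p < v) (sym (parentFace-stable 3≤v v<N)) (apex-parentFace 3≤v v<N)
  ... | no v≮N with new-vertex (≮⇒≥ v≮N) v<N′
  ...   | j , j< , refl = subst (λ p → apex p < N n + j) (sym (parentFace-new j))
                            (<-≤-trans (apex< (F-isTriangle j<)) (m≤m+n (N n) j))

  faces-unique′ : Unique (insertionFaces (suc n) ++ F (suc n))
  faces-unique′ = Unique.++⁺ faces-unique (subdivide-faces-unique (N n) (F n) ascending) disjoint
    where
    ascending : All Ascending (F n)
    ascending = All.tabulate λ t∈ → let (a<b , b<c , _) = proj₁ (face-shape (∈-++⁺ʳ _ t∈)) in a<b , b<c
    disjoint : ∀ {t} → ¬ (t ∈ insertionFaces n ++ F n × t ∈ F (suc n))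
    disjoint (old , new) = <⇒≱ (apex< (proj₁ (face-shape old))) (subdivide-faces-apex (N n) (F n) new)

  invariant′ : Invariant (suc n)
  invariant′ = record
    { insertionFaces-length = begin
        length (insertionFaces n ++ F n) + 3              ≡⟨ cong (_+ 3) (length-++ (insertionFaces n)) ⟩
        length (insertionFaces n) + length (F n) + 3      ≡⟨ +-assoc _ (length (F n)) 3 ⟩
        length (insertionFaces n) + (length (F n) + 3)    ≡⟨ cong (length (insertionFaces n) +_) (+-comm (length (F n)) 3) ⟩
        length (insertionFaces n) + (3 + length (F n))    ≡⟨ +-assoc _ 3 (length (F n)) ⟨
        length (insertionFaces n) + 3 + length (F n)      ≡⟨ cong (_+ length (F n)) insertionFaces-length ⟩
        N (suc n)                                         ∎
    ; edge-shape      = edge-shape′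
    ; face-shape      = face-shape′
    ; apex-parentFace = apex-parentFace′
    ; faces-unique    = faces-unique′
    }
    where open ≡-Reasoning

invariant : ∀ n → Invariant n
invariant zero    = invariant-zero
invariant (suc n) = Step.invariant′ n (invariant n)

edge01 : ∀ n → (0 , 1) ∈ E n
edge01 zero    = here refl
edge01 (suc n) = ∈-++⁺ˡ (edge01 n)

module Neighbourhood (n : ℕ) where
  open Shape (invariant n) public

  Lower : ℕ → ℕ → Set
  Lower x v = (x , v) ∈ E n

  Adjacent : ℕ → ℕ → Set
  Adjacent u v = Lower u v ⊎ Lower v u

  lower-< : ∀ {x v} → Lower x v → x < v
  lower-< x<v = proj₁ (edge-shape x<v)

  lower-initial : ∀ {x v} → Lower x v → v ≤ 2 → x ≡ 0 ⊎ x ≡ 1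
  lower-initial xv v≤2 with edge-shape xv
  ... | _ , _ , inj₁ (_ , x≡0∨1) = x≡0∨1
  ... | _ , _ , inj₂ (3≤v , _)    = ⊥-elim (<⇒≱ (s≤s v≤2) 3≤v)

  lower-parentFace : ∀ {x v} → 3 ≤ v → Lower x v → v < N n × x ∈▵ parentFace n v
  lower-parentFace 3≤v xv with edge-shape xv
  ... | _ , v<N , inj₁ (v≤2 , _) = ⊥-elim (<⇒≱ (s≤s v≤2) 3≤v)
  ... | _ , v<N , inj₂ (_ , x∈)  = v<N , x∈

  isTriangle-adjacent : ∀ {t x y} → IsTriangle n t → x ∈▵ t → y ∈▵ t → x ≢ y → Adjacent x y
  isTriangle-adjacent (_ , _ , _ , ab , bc , ac) = λ where
    (inj₁ refl)        (inj₁ refl)        x≢y → ⊥-elim (x≢y refl)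
    (inj₁ refl)        (inj₂ (inj₁ refl)) _   → inj₁ ab
    (inj₁ refl)        (inj₂ (inj₂ refl)) _   → inj₁ ac
    (inj₂ (inj₁ refl)) (inj₁ refl)        _   → inj₂ ab
    (inj₂ (inj₁ refl)) (inj₂ (inj₁ refl)) x≢y → ⊥-elim (x≢y refl)
    (inj₂ (inj₁ refl)) (inj₂ (inj₂ refl)) _   → inj₁ bc
    (inj₂ (inj₂ refl)) (inj₁ refl)        _   → inj₂ ac
    (inj₂ (inj₂ refl)) (inj₂ (inj₁ refl)) _   → inj₂ bc
    (inj₂ (inj₂ refl)) (inj₂ (inj₂ refl)) x≢y → ⊥-elim (x≢y refl)

  lower-adjacent : ∀ {x y v} → Lower x v → Lower y v → x ≢ y → Adjacent x y
  lower-adjacent {x} {y} {v} xv yv x≢y with v ≤? 2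
  ... | yes v≤2 = initial (lower-initial xv v≤2) (lower-initial yv v≤2)
    where
    initial : x ≡ 0 ⊎ x ≡ 1 → y ≡ 0 ⊎ y ≡ 1 → Adjacent x y
    initial (inj₁ refl) (inj₁ refl) = ⊥-elim (x≢y refl)
    initial (inj₁ refl) (inj₂ refl) = inj₁ (edge01 n)
    initial (inj₂ refl) (inj₁ refl) = inj₂ (edge01 n)
    initial (inj₂ refl) (inj₂ refl) = ⊥-elim (x≢y refl)
  ... | no v≰2 =
    let 3≤v = ≰⇒> v≰2 ; (v<N , x∈) = lower-parentFace 3≤v xv ; (_ , y∈) = lower-parentFace 3≤v yv
    in  isTriangle-adjacent (proj₁ (parentFace-shape 3≤v v<N)) x∈ y∈ x≢y

-- Vertex labellings

Labelling : Set
Labelling = ℕ → Bool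

Rule : Set
Rule = Labelling → Triple → Bool

labels : Rule → ℕ → List Bool
labels r zero    = false ∷ false ∷ true ∷ []
labels r (suc n) = labels r n ++ map (r (lookupOr false (labels r n))) (F n)

label : Rule → ℕ → Labelling
label r n = lookupOr false (labels r n)

Local : Rule → Set
Local r = ∀ {ℓ ℓ′} t → (∀ {x} → x ∈▵ t → ℓ x ≡ ℓ′ x) → r ℓ t ≡ r ℓ′ t

module _ (r : Rule) where

  length-labels : ∀ n → length (labels r n) ≡ N n
  length-labels zero    = refl
  length-labels (suc n) =
    trans (length-++ (labels r n)) (cong₂ _+_ (length-labels n) (length-map _ (F n)))

  label-stable : ∀ n {v} → v < N n → label r (suc n) v ≡ label r n v
  label-stable n v<N = lookupOr-++ˡ false (labels r n) _ (subst (_ <_) (sym (length-labels n)) v<N)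

  label-new : ∀ n {j} → j < length (F n) →
              label r (suc n) (N n + j) ≡ r (label r n) (lookupOr defaultTriple (F n) j)
  label-new n {j} j< = begin
    label r (suc n) (N n + j)                          ≡⟨ cong (λ m → label r (suc n) (m + j)) (length-labels n) ⟨
    label r (suc n) (length (labels r n) + j)          ≡⟨ lookupOr-++ʳ false (labels r n) _ j ⟩
    lookupOr false (map (r (label r n)) (F n)) j       ≡⟨ lookupOr-map defaultTriple false (r (label r n)) (F n) j< ⟩
    r (label r n) (lookupOr defaultTriple (F n) j)     ∎
    where open ≡-Reasoning

  label-stable-▵ : ∀ n {t x} → IsTriangle n t → x ∈▵ t → label r n x ≡ label r (suc n) x
  label-stable-▵ n tri x∈ = sym (label-stable n (Shape.∈▵-< (invariant n) tri x∈))

  label-initial : ∀ n {v} → v < 3 → label r n v ≡ label r 0 v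
  label-initial zero    v<3 = refl
  label-initial (suc n) v<3 = trans (label-stable n (<-≤-trans v<3 (3≤N n))) (label-initial n v<3)

  label-parentFace : Local r → ∀ n {v} → 3 ≤ v → v < N n → label r n v ≡ r (label r n) (parentFace n v)
  label-parentFace local zero    3≤v v<3 = ⊥-elim (<⇒≱ v<3 3≤v)
  label-parentFace local (suc n) {v} 3≤v v<N′ with v <? N n
  ... | yes v<N = begin
    label r (suc n) v                        ≡⟨ label-stable n v<N ⟩
    label r n v                              ≡⟨ label-parentFace local n 3≤v v<N ⟩
    r (label r n) (parentFace n v)           ≡⟨ local _ (label-stable-▵ n (proj₁ (parentFace-shape 3≤v v<N))) ⟩
    r (label r (suc n)) (parentFace n v)     ≡⟨ cong (r (label r (suc n))) (parentFace-stable 3≤v v<N) ⟨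
    r (label r (suc n)) (parentFace (suc n) v) ∎
    where open ≡-Reasoning
          open Step n (invariant n)
  ... | no v≮N with Step.new-vertex n (invariant n) (≮⇒≥ v≮N) v<N′
  ...   | j , j< , refl = begin
    label r (suc n) (N n + j)                                ≡⟨ label-new n j< ⟩
    r (label r n) (lookupOr defaultTriple (F n) j)           ≡⟨ local _ (label-stable-▵ n (F-isTriangle j<)) ⟩
    r (label r (suc n)) (lookupOr defaultTriple (F n) j)     ≡⟨ cong (r (label r (suc n))) (parentFace-new j) ⟨
    r (label r (suc n)) (parentFace (suc n) (N n + j))       ∎
    where open ≡-Reasoning
          open Step n (invariant n)

NonMonochromatic : Labelling → Triple → Set
NonMonochromatic ℓ (a , b , c) = ¬ (ℓ a ≡ ℓ b × ℓ b ≡ ℓ c)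

nonMonochromatic-cong : ∀ {ℓ ℓ′} t → (∀ {x} → x ∈▵ t → ℓ x ≡ ℓ′ x) →
                        NonMonochromatic ℓ t → NonMonochromatic ℓ′ t
nonMonochromatic-cong t ℓ≡ℓ′ nm (ab , bc) =
  nm ( trans (ℓ≡ℓ′ (inj₁ refl)) (trans ab (sym (ℓ≡ℓ′ (inj₂ (inj₁ refl)))))
     , trans (ℓ≡ℓ′ (inj₂ (inj₁ refl))) (trans bc (sym (ℓ≡ℓ′ (inj₂ (inj₂ refl))))))

-- On a non-monochromatic triple the xor of the three labels is the label occurring only once.
minorityRule : Rule
minorityRule ℓ (a , b , c) = ℓ a xor ℓ b xor ℓ c

minorityRule-local : Local minorityRule
minorityRule-local t ℓ≡ℓ′ =
  cong₂ _xor_ (ℓ≡ℓ′ (inj₁ refl)) (cong₂ _xor_ (ℓ≡ℓ′ (inj₂ (inj₁ refl))) (ℓ≡ℓ′ (inj₂ (inj₂ refl))))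

xor-minority-exists : ∀ p q r → let s = p xor q xor r in p ≡ s ⊎ q ≡ s ⊎ r ≡ s
xor-minority-exists false false false = inj₁ refl
xor-minority-exists false false true  = inj₂ (inj₂ refl)
xor-minority-exists false true  false = inj₂ (inj₁ refl)
xor-minority-exists false true  true  = inj₁ refl
xor-minority-exists true  false false = inj₁ refl
xor-minority-exists true  false true  = inj₂ (inj₁ refl)
xor-minority-exists true  true  false = inj₂ (inj₂ refl)
xor-minority-exists true  true  true  = inj₁ refl

xor-minority-unique : ∀ p q r → ¬ (p ≡ q × q ≡ r) → let s = p xor q xor r in
                      ¬ (p ≡ s × q ≡ s) × ¬ (q ≡ s × r ≡ s) × ¬ (p ≡ s × r ≡ s)
xor-minority-unique false false false nm = ⊥-elim (nm (refl , refl))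
xor-minority-unique false false true  _  = (λ { (() , _) }) , (λ { (() , _) }) , (λ { (() , _) })
xor-minority-unique false true  false _  = (λ { (() , _) }) , (λ { (_ , ()) }) , (λ { (() , _) })
xor-minority-unique false true  true  _  = (λ { (_ , ()) }) , (λ { (() , _) }) , (λ { (_ , ()) })
xor-minority-unique true  false false _  = (λ { (_ , ()) }) , (λ { (() , _) }) , (λ { (_ , ()) })
xor-minority-unique true  false true  _  = (λ { (() , _) }) , (λ { (_ , ()) }) , (λ { (() , _) })
xor-minority-unique true  true  false _  = (λ { (() , _) }) , (λ { (() , _) }) , (λ { (() , _) })
xor-minority-unique true  true  true  nm = ⊥-elim (nm (refl , refl))

module _ (ℓ : Labelling) where

  minorityVertex : ∀ t → NonMonochromatic ℓ t →
    ∃[ m ] m ∈▵ t × ℓ m ≡ minorityRule ℓ t × (∀ {x} → x ∈▵ t → ℓ x ≡ minorityRule ℓ t → x ≡ m)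
  minorityVertex (a , b , c) nm
    with xor-minority-exists (ℓ a) (ℓ b) (ℓ c) | xor-minority-unique (ℓ a) (ℓ b) (ℓ c) nm
  ... | inj₁ ma | ¬ab , ¬bc , ¬ac = a , inj₁ refl , ma , λ
    { (inj₁ refl) _ → refl ; (inj₂ (inj₁ refl)) mb → ⊥-elim (¬ab (ma , mb)) ; (inj₂ (inj₂ refl)) mc → ⊥-elim (¬ac (ma , mc)) }
  ... | inj₂ (inj₁ mb) | ¬ab , ¬bc , ¬ac = b , inj₂ (inj₁ refl) , mb , λ
    { (inj₁ refl) ma → ⊥-elim (¬ab (ma , mb)) ; (inj₂ (inj₁ refl)) _ → refl ; (inj₂ (inj₂ refl)) mc → ⊥-elim (¬bc (mb , mc)) }
  ... | inj₂ (inj₂ mc) | ¬ab , ¬bc , ¬ac = c , inj₂ (inj₂ refl) , mc , λ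
    { (inj₁ refl) ma → ⊥-elim (¬ac (ma , mc)) ; (inj₂ (inj₁ refl)) mb → ⊥-elim (¬bc (mb , mc)) ; (inj₂ (inj₂ refl)) _ → refl }

  children-nonMonochromatic : ∀ {t w s} → NonMonochromatic ℓ t → ℓ w ≡ minorityRule ℓ t →
                              s ∈ children t w → NonMonochromatic ℓ s
  children-nonMonochromatic {a , b , c} nm mw s∈ with xor-minority-unique (ℓ a) (ℓ b) (ℓ c) nm | s∈
  ... | ¬ab , ¬bc , ¬ac | here refl                 = λ (ab , bw) → ¬ab (trans ab (trans bw mw) , trans bw mw)
  ... | ¬ab , ¬bc , ¬ac | there (here refl)         = λ (bc , cw) → ¬bc (trans bc (trans cw mw) , trans cw mw)
  ... | ¬ab , ¬bc , ¬ac | there (there (here refl)) = λ (ac , cw) → ¬ac (trans ac (trans cw mw) , trans cw mw)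

minorityLabel : ℕ → Labelling
minorityLabel = label minorityRule

faces-nonMonochromatic : ∀ n {t} → t ∈ insertionFaces n ++ F n → NonMonochromatic (minorityLabel n) t
faces-nonMonochromatic zero (here refl) (_ , ())
faces-nonMonochromatic (suc n) t∈ with ∈-++⁻ (insertionFaces n ++ F n) t∈
... | inj₁ old = nonMonochromatic-cong _ (label-stable-▵ minorityRule n (proj₁ (Shape.face-shape (invariant n) old)))
                   (faces-nonMonochromatic n old)
... | inj₂ new with ∈-subdivide-faces⁻ (N n) (F n) new
...   | j , j< , s∈c =
  children-nonMonochromatic (minorityLabel (suc n))
    (nonMonochromatic-cong _ stable
      (faces-nonMonochromatic n (∈-++⁺ʳ (insertionFaces n) (lookupOr-∈ defaultTriple (F n) j<))))
    (trans (label-new minorityRule n j<) (minorityRule-local _ stable))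
    s∈c
  where
  stable : ∀ {x} → x ∈▵ lookupOr defaultTriple (F n) j → minorityLabel n x ≡ minorityLabel (suc n) x
  stable = label-stable-▵ minorityRule n (Step.F-isTriangle n (invariant n) j<)

-- The colouring for cycles and H⁺

module MinorityColouring (n : ℕ) where
  open Neighbourhood n public

  μ : Labelling
  μ = minorityLabel n

  μ-initial : μ 0 ≡ false × μ 1 ≡ false × μ 2 ≡ true
  μ-initial = label-initial minorityRule n (s≤s z≤n)
            , label-initial minorityRule n (s≤s (s≤s z≤n))
            , label-initial minorityRule n (s≤s (s≤s (s≤s z≤n)))

  parentFace-minorityVertex : ∀ {v} → 3 ≤ v → v < N n →
    ∃[ m ] m ∈▵ parentFace n v × μ m ≡ μ v × (∀ {x} → x ∈▵ parentFace n v → μ x ≡ μ v → x ≡ m)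
  parentFace-minorityVertex {v} 3≤v v<N
    with minorityVertex μ (parentFace n v) (faces-nonMonochromatic n (parentFace-∈ 3≤v v<N))
  ... | m , m∈ , μm , unique = m , m∈ , trans μm (sym μv) , λ x∈ μx → unique x∈ (trans μx μv)
    where
    μv : μ v ≡ minorityRule μ (parentFace n v)
    μv = label-parentFace minorityRule minorityRule-local n 3≤v v<N

  initial-sameLabel : ∀ {x v} → Lower x v → v ≤ 2 → μ x ≡ μ v → x ≡ 0
  initial-sameLabel xv v≤2 μx≡μv with lower-initial xv v≤2
  ... | inj₁ x≡0 = x≡0
  ... | inj₂ refl with ≤-antisym v≤2 (lower-< xv)
  ...   | refl = case trans (sym (proj₁ (proj₂ μ-initial))) (trans μx≡μv (proj₂ (proj₂ μ-initial))) of λ ()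

  lower-sameLabel-unique : ∀ {v} → AtMostOne (λ x → Lower x v × μ x ≡ μ v)
  lower-sameLabel-unique {v} (xv , μx) (yv , μy) with v ≤? 2
  ... | yes v≤2 = trans (initial-sameLabel xv v≤2 μx) (sym (initial-sameLabel yv v≤2 μy))
  ... | no v≰2 with lower-parentFace (≰⇒> v≰2) xv | lower-parentFace (≰⇒> v≰2) yv
  ...   | v<N , x∈ | _ , y∈ with parentFace-minorityVertex (≰⇒> v≰2) v<N
  ...     | m , _ , _ , unique = trans (unique x∈ μx) (sym (unique y∈ μy))

  lower-otherLabel-atMostTwo : ∀ {v} → AtMostTwo (λ x → Lower x v × μ x ≢ μ v)
  lower-otherLabel-atMostTwo {v} with v ≤? 2
  ... | yes v≤2 = atMostTwo-⊆ (λ (xv , _) → lower-initial xv v≤2) (atMostTwo-pair 0 1)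
  ... | no v≰2 = λ px py pz → let v<N = proj₁ (lower-parentFace 3≤v (proj₁ px)) in
      case parentFace-minorityVertex 3≤v v<N of λ (m , m∈ , μm , _) →
        atMostTwo-⊆ (λ (xv , μx≢μv) → proj₂ (lower-parentFace 3≤v xv) , λ { refl → μx≢μv μm })
                    (atMostTwo-∈▵-≢ (parentFace n v) m∈) px py pz
    where
    3≤v : 3 ≤ v
    3≤v = ≰⇒> v≰2

  minColour : ℕ → ℕ → Bool
  minColour u v = μ (u ⊓ v)

  minColour-sym : ∀ u v → minColour u v ≡ minColour v u
  minColour-sym u v = cong μ (⊓-comm u v)

  MonoEdge : Bool → ℕ → ℕ → Set
  MonoEdge b u v = Adjacent u v × minColour u v ≡ b

  monoEdge-sym : ∀ {b u v} → MonoEdge b u v → MonoEdge b v u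
  monoEdge-sym {u = u} {v} (uv , c) = swap uv , trans (cong μ (⊓-comm v u)) c

  monoEdge-lower : ∀ {b u v} → MonoEdge b u v → (Lower u v × μ u ≡ b) ⊎ (Lower v u × μ v ≡ b)
  monoEdge-lower (inj₁ uv , c) = inj₁ (uv , trans (cong μ (sym (m≤n⇒m⊓n≡m (<⇒≤ (lower-< uv))))) c)
  monoEdge-lower (inj₂ vu , c) = inj₂ (vu , trans (cong μ (sym (m≥n⇒m⊓n≡n (<⇒≤ (lower-< vu))))) c)

  otherLabel-monoEdges-atMostTwo : ∀ {b w} → μ w ≢ b → AtMostTwo (MonoEdge b w)
  otherLabel-monoEdges-atMostTwo {b} {w} μw≢b =
    atMostTwo-⊆ lower-otherLabel lower-otherLabel-atMostTwo
    where
    lower-otherLabel : ∀ {x} → MonoEdge b w x → Lower x w × μ x ≢ μ w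
    lower-otherLabel e with monoEdge-lower e
    ... | inj₁ (_ , μw≡b)  = ⊥-elim (μw≢b μw≡b)
    ... | inj₂ (xw , μx≡b) = xw , λ μx≡μw → μw≢b (trans (sym μx≡μw) μx≡b)

  Dominated : Bool → ℕ → ℕ → Set
  Dominated b m x = μ x ≡ b → x ≤ m

  sameLabel-lower-neighbour : ∀ {b m j j′} → μ m ≡ b → MonoEdge b m j → MonoEdge b j j′ → j′ ≢ m →
    Dominated b m j → Dominated b m j′ →
    ∃[ w ] (w ≡ j ⊎ (w ≡ j′ × μ j ≢ b)) × Lower w m × μ w ≡ μ m
  sameLabel-lower-neighbour {j = j} {j′} μm mj jj′ j′≢m dj dj′ with monoEdge-lower mj
  ... | inj₂ (jm , μj) = j , inj₁ refl , jm , trans μj (sym μm)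
  ... | inj₁ (m<j , _) with monoEdge-lower jj′
  ...   | inj₁ (_ , μj) = ⊥-elim (<⇒≱ (lower-< m<j) (dj μj))
  ...   | inj₂ (j′j , μj′) with lower-adjacent m<j j′j (j′≢m ∘ sym)
  ...     | inj₁ mj′ = ⊥-elim (<⇒≱ (lower-< mj′) (dj′ μj′))
  ...     | inj₂ j′m = j′ , inj₂ (refl , λ μj → <⇒≱ (lower-< m<j) (dj μj)) , j′m , trans μj′ (sym μm)

  monoWalk-through-maximum : ∀ {b v₀ v₁ v₂ v₃ v₄} →
    MonoEdge b v₀ v₁ → MonoEdge b v₁ v₂ → MonoEdge b v₂ v₃ → MonoEdge b v₃ v₄ → μ v₂ ≡ b →
    Dominated b v₂ v₀ → Dominated b v₂ v₁ → Dominated b v₂ v₃ → Dominated b v₂ v₄ →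
    v₀ ≢ v₂ → v₄ ≢ v₂ →
    v₃ ≡ v₁ ⊎ v₃ ≡ v₀ ⊎ v₄ ≡ v₁ ⊎ (v₄ ≡ v₀ × μ v₁ ≢ b × μ v₃ ≢ b)
  monoWalk-through-maximum e₀₁ e₁₂ e₂₃ e₃₄ μ₂ d₀ d₁ d₃ d₄ v₀≢v₂ v₄≢v₂
    with sameLabel-lower-neighbour μ₂ e₂₃ e₃₄ v₄≢v₂ d₃ d₄
       | sameLabel-lower-neighbour μ₂ (monoEdge-sym e₁₂) (monoEdge-sym e₀₁) v₀≢v₂ d₁ d₀
  ... | w , w≡ , wv₂ , μw | w′ , w′≡ , w′v₂ , μw′
    with lower-sameLabel-unique (wv₂ , μw) (w′v₂ , μw′) | w≡ | w′≡
  ... | refl | inj₁ refl        | inj₁ refl        = inj₁ refl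
  ... | refl | inj₁ refl        | inj₂ (refl , _)  = inj₂ (inj₁ refl)
  ... | refl | inj₂ (refl , _)  | inj₁ refl        = inj₂ (inj₂ (inj₁ refl))
  ... | refl | inj₂ (refl , μ₃) | inj₂ (refl , μ₁) = inj₂ (inj₂ (inj₂ (refl , μ₁ , μ₃)))

  monoSquare-maximum : ∀ {b v₀ v₁ v₂ v₃} →
    MonoEdge b v₀ v₁ → MonoEdge b v₁ v₂ → MonoEdge b v₂ v₃ → MonoEdge b v₃ v₀ → μ v₀ ≡ b →
    Dominated b v₀ v₁ → Dominated b v₀ v₂ → Dominated b v₀ v₃ →
    v₂ ≢ v₀ → v₁ ≢ v₃ → v₁ ≢ v₂ → v₂ ≢ v₃ → μ v₁ ≢ b × μ v₃ ≢ b
  monoSquare-maximum e₀₁ e₁₂ e₂₃ e₃₀ μ₀ d₁ d₂ d₃ v₂≢v₀ v₁≢v₃ v₁≢v₂ v₂≢v₃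
    with monoWalk-through-maximum e₂₃ e₃₀ e₀₁ e₁₂ μ₀ d₂ d₃ d₁ d₂ v₂≢v₀ v₂≢v₀
  ... | inj₁ v₁≡v₃                     = ⊥-elim (v₁≢v₃ v₁≡v₃)
  ... | inj₂ (inj₁ v₁≡v₂)              = ⊥-elim (v₁≢v₂ v₁≡v₂)
  ... | inj₂ (inj₂ (inj₁ v₂≡v₃))       = ⊥-elim (v₂≢v₃ v₂≡v₃)
  ... | inj₂ (inj₂ (inj₂ (_ , μ₃ , μ₁))) = μ₁ , μ₃

  monoSquare-pendant : ∀ {b v₀ v₁ v₂ v₃ p} →
    MonoEdge b v₀ v₁ → MonoEdge b v₁ v₂ → MonoEdge b v₂ v₃ → MonoEdge b v₃ v₀ → MonoEdge b v₁ p → μ v₀ ≡ b →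
    Dominated b v₀ v₁ → Dominated b v₀ v₂ → Dominated b v₀ v₃ →
    v₂ ≢ v₀ → v₁ ≢ v₃ → v₁ ≢ v₂ → v₂ ≢ v₃ → v₀ ≢ p → v₂ ≢ p → ⊥
  monoSquare-pendant e₀₁ e₁₂ e₂₃ e₃₀ e₁p μ₀ d₁ d₂ d₃ v₂≢v₀ v₁≢v₃ v₁≢v₂ v₂≢v₃ v₀≢p v₂≢p =
    let (μ₁≢b , _) = monoSquare-maximum e₀₁ e₁₂ e₂₃ e₃₀ μ₀ d₁ d₂ d₃ v₂≢v₀ v₁≢v₃ v₁≢v₂ v₂≢v₃
    in  atMostTwo-distinct (otherLabel-monoEdges-atMostTwo μ₁≢b)
          (monoEdge-sym e₀₁) e₁₂ e₁p (v₂≢v₀ ∘ sym) v₀≢p v₂≢p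

  no-monoHplus : ∀ {b} (ψ : Fin 6 → ℕ) → Injective _≡_ _≡_ ψ →
                 (∀ i j → Adj Hplus i j → MonoEdge b (ψ i) (ψ j)) → ⊥
  no-monoHplus {b} ψ ψ-injective edge =
    let (m , m∈ , μm , bound) = argmax-∈ ψ (λ i → μ (ψ i) ≟ᵇ b) (proj₁ (proj₂ start)) (proj₂ (proj₂ start))
    in  around m m∈ μm bound
    where
    infix 4 _≉_
    _≉_ : ∀ i j {i≢j : False (i Fin.≟ j)} → ψ i ≢ ψ j
    _≉_ = injective-≢ ψ-injective
    e₀₁ : MonoEdge b (ψ (# 0)) (ψ (# 1))
    e₀₁ = edge (# 0) (# 1) (inj₁ (here refl))
    e₁₂ : MonoEdge b (ψ (# 1)) (ψ (# 2))
    e₁₂ = edge (# 1) (# 2) (inj₁ (there (here refl)))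
    e₂₃ : MonoEdge b (ψ (# 2)) (ψ (# 3))
    e₂₃ = edge (# 2) (# 3) (inj₁ (there (there (here refl))))
    e₃₀ : MonoEdge b (ψ (# 3)) (ψ (# 0))
    e₃₀ = edge (# 3) (# 0) (inj₁ (there (there (there (here refl)))))
    e₀₄ : MonoEdge b (ψ (# 0)) (ψ (# 4))
    e₀₄ = edge (# 0) (# 4) (inj₁ (there (there (there (there (here refl))))))
    e₁₅ : MonoEdge b (ψ (# 1)) (ψ (# 5))
    e₁₅ = edge (# 1) (# 5) (inj₁ (there (there (there (there (there (here refl)))))))
    square : List (Fin 6)
    square = # 0 ∷ # 1 ∷ # 2 ∷ # 3 ∷ []
    start : ∃[ i ] i ∈ square × μ (ψ i) ≡ b
    start with monoEdge-lower e₀₁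
    ... | inj₁ (_ , μ₀) = # 0 , here refl , μ₀
    ... | inj₂ (_ , μ₁) = # 1 , there (here refl) , μ₁
    around : ∀ m → m ∈ square → μ (ψ m) ≡ b → (∀ {j} → j ∈ square → Dominated b (ψ m) (ψ j)) → ⊥
    around _ (here refl) μ₀ d = monoSquare-pendant e₀₁ e₁₂ e₂₃ e₃₀ e₁₅ μ₀
      (d (there (here refl))) (d (there (there (here refl)))) (d (there (there (there (here refl)))))
      (# 2 ≉ # 0) (# 1 ≉ # 3) (# 1 ≉ # 2) (# 2 ≉ # 3) (# 0 ≉ # 5) (# 2 ≉ # 5)
    around _ (there (here refl)) μ₁ d = monoSquare-pendant
      (monoEdge-sym e₀₁) (monoEdge-sym e₃₀) (monoEdge-sym e₂₃) (monoEdge-sym e₁₂) e₀₄ μ₁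
      (d (here refl)) (d (there (there (there (here refl))))) (d (there (there (here refl))))
      (# 3 ≉ # 1) (# 0 ≉ # 2) (# 0 ≉ # 3) (# 3 ≉ # 2) (# 1 ≉ # 4) (# 3 ≉ # 4)
    around _ (there (there (here refl))) μ₂ d = monoSquare-pendant
      (monoEdge-sym e₁₂) (monoEdge-sym e₀₁) (monoEdge-sym e₃₀) (monoEdge-sym e₂₃) e₁₅ μ₂
      (d (there (here refl))) (d (here refl)) (d (there (there (there (here refl)))))
      (# 0 ≉ # 2) (# 1 ≉ # 3) (# 1 ≉ # 0) (# 0 ≉ # 3) (# 2 ≉ # 5) (# 0 ≉ # 5)
    around _ (there (there (there (here refl)))) μ₃ d = monoSquare-pendant e₃₀ e₀₁ e₁₂ e₂₃ e₀₄ μ₃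
      (d (here refl)) (d (there (here refl))) (d (there (there (here refl))))
      (# 1 ≉ # 3) (# 0 ≉ # 2) (# 0 ≉ # 1) (# 1 ≉ # 2) (# 3 ≉ # 4) (# 1 ≉ # 4)

  no-monoCycle : ∀ {b K} → 4 ≤ K → (ψ : Fin (suc K) → ℕ) → Injective _≡_ _≡_ ψ →
                 (∀ i j → Adj (Cycle (suc K)) i j → MonoEdge b (ψ i) (ψ j)) → ⊥
  no-monoCycle {b} {K} 4≤K ψ ψ-injective edge =
    let (m , _ , μm , bound) = argmax-∈ ψ (λ i → μ (ψ i) ≟ᵇ b) (∈-allFin (proj₁ start)) (proj₂ start)
    in  around m μm (λ {j} → bound (∈-allFin j))
    where
    χ : ℕ → ℕ
    χ t = ψ (t mod suc K)
    step : ∀ t → MonoEdge b (χ t) (χ (suc t))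
    step t = edge _ _ (cycle-mod-adjacent K t)
    apart : ∀ r d → 0 < d → d ≤ 4 → χ r ≢ χ (d + r)
    apart r d 0<d d≤4 = mod-shift-≢ r 0<d (s≤s (≤-trans d≤4 4≤K)) ∘ ψ-injective
    start : ∃[ i ] μ (ψ i) ≡ b
    start with monoEdge-lower (step 0)
    ... | inj₁ (_ , μ₀) = _ , μ₀
    ... | inj₂ (_ , μ₁) = _ , μ₁
    around : ∀ m → μ (ψ m) ≡ b → (∀ {j} → Dominated b (ψ m) (ψ j)) → ⊥
    around m μm d = refute (monoWalk-through-maximum (step u) (step (1 + u)) (step (2 + u)) (step (3 + u))
                             (subst (λ v → μ v ≡ b) (cong ψ (sym centre)) μm)
                             (dominated u) (dominated (1 + u)) (dominated (3 + u)) (dominated (4 + u))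
                             (apart u 2 z<s 2≤4) (apart (2 + u) 2 z<s 2≤4 ∘ sym))
      where
      u : ℕ
      u = K ∸ 1 + toℕ m
      2≤4 : 2 ≤ 4
      2≤4 = s≤s (s≤s z≤n)
      3≤4 : 3 ≤ 4
      3≤4 = s≤s (s≤s (s≤s z≤n))
      centre : (2 + u) mod suc K ≡ m
      centre = begin
        (2 + u) mod suc K          ≡⟨ cong (λ x → suc x mod suc K) (cong (_+ toℕ m) (m+[n∸m]≡n (≤-trans z<s 4≤K))) ⟩
        suc (K + toℕ m) mod suc K  ≡⟨ cong (λ x → suc x mod suc K) (+-comm K (toℕ m)) ⟩
        suc (toℕ m + K) mod suc K  ≡⟨ cong (_mod suc K) (+-suc (toℕ m) K) ⟨
        (toℕ m + suc K) mod suc K  ≡⟨ toℕ+k-mod m ⟩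
        m                          ∎
        where open ≡-Reasoning
      dominated : ∀ t → Dominated b (χ (2 + u)) (χ t)
      dominated t μt = subst (χ t ≤_) (cong ψ (sym centre)) (d μt)
      refute : χ (3 + u) ≡ χ (1 + u) ⊎ χ (3 + u) ≡ χ u ⊎ χ (4 + u) ≡ χ (1 + u) ⊎
               (χ (4 + u) ≡ χ u × μ (χ (1 + u)) ≢ b × μ (χ (3 + u)) ≢ b) → ⊥
      refute (inj₁ v₃≡v₁)                    = apart (1 + u) 2 z<s 2≤4 (sym v₃≡v₁)
      refute (inj₂ (inj₁ v₃≡v₀))             = apart u 3 z<s 3≤4 (sym v₃≡v₀)
      refute (inj₂ (inj₂ (inj₁ v₄≡v₁)))      = apart (1 + u) 3 z<s 3≤4 (sym v₄≡v₁)
      refute (inj₂ (inj₂ (inj₂ (v₄≡v₀ , _)))) = apart u 4 z<s ≤-refl (sym v₄≡v₀)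

-- The colouring for K_{2,3}

flipRule : Rule
flipRule ℓ t = not (ℓ (apex t))

flipRule-local : Local flipRule
flipRule-local t ℓ≡ℓ′ = cong not (ℓ≡ℓ′ (inj₂ (inj₂ refl)))

-- For the children (a , b , w), (b , c , w), (a , c , w) of (a , b , c) this is a, b, c respectively.
inheritedVertex : Triple → Triple → ℕ
inheritedVertex (x , y , _) (a , _ , c) = if does (x ≟ a) ∧ does (y ≟ c) then y else x

inheritedVertex-base : ∀ s t → inheritedVertex s t ≡ proj₁ s ⊎ inheritedVertex s t ≡ proj₁ (proj₂ s)
inheritedVertex-base (x , y , _) (a , _ , c) with does (x ≟ a) ∧ does (y ≟ c)
... | true  = inj₂ refl
... | false = inj₁ refl

inheritedVertex-children : ∀ {a b c w s} → a < b → b < c → s ∈ children (a , b , c) w →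
  (s ≡ (a , b , w) × inheritedVertex s (a , b , c) ≡ a) ⊎
  (s ≡ (b , c , w) × inheritedVertex s (a , b , c) ≡ b) ⊎
  (s ≡ (a , c , w) × inheritedVertex s (a , b , c) ≡ c)
inheritedVertex-children {a} {b} {c} a<b b<c (here refl)
  rewrite dec-true (a ≟ a) refl | dec-false (b ≟ c) (<⇒≢ b<c) = inj₁ (refl , refl)
inheritedVertex-children {a} {b} {c} a<b b<c (there (here refl))
  rewrite dec-false (b ≟ a) (<⇒≢ a<b ∘ sym) = inj₂ (inj₁ (refl , refl))
inheritedVertex-children {a} {b} {c} a<b b<c (there (there (here refl)))
  rewrite dec-true (a ≟ a) refl | dec-true (c ≟ c) refl = inj₂ (inj₂ (refl , refl))

inheritedVertex-injective : ∀ {t w s s′} → Ascending t → s ∈ children t w → s′ ∈ children t w →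
                            inheritedVertex s t ≡ inheritedVertex s′ t → s ≡ s′
inheritedVertex-injective (a<b , b<c) s∈ s′∈ same
  with inheritedVertex-children a<b b<c s∈ | inheritedVertex-children a<b b<c s′∈
... | inj₁ (refl , _)        | inj₁ (refl , _)          = refl
... | inj₂ (inj₁ (refl , _)) | inj₂ (inj₁ (refl , _))   = refl
... | inj₂ (inj₂ (refl , _)) | inj₂ (inj₂ (refl , _))   = refl
... | inj₁ (_ , i)           | inj₂ (inj₁ (_ , i′))     = ⊥-elim (<⇒≢ a<b (trans (sym i) (trans same i′)))
... | inj₁ (_ , i)           | inj₂ (inj₂ (_ , i′))     = ⊥-elim (<⇒≢ (<-trans a<b b<c) (trans (sym i) (trans same i′)))
... | inj₂ (inj₁ (_ , i))    | inj₂ (inj₂ (_ , i′))     = ⊥-elim (<⇒≢ b<c (trans (sym i) (trans same i′)))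
... | inj₂ (inj₁ (_ , i))    | inj₁ (_ , i′)            = ⊥-elim (<⇒≢ a<b (trans (sym i′) (trans (sym same) i)))
... | inj₂ (inj₂ (_ , i))    | inj₁ (_ , i′)            = ⊥-elim (<⇒≢ (<-trans a<b b<c) (trans (sym i′) (trans (sym same) i)))
... | inj₂ (inj₂ (_ , i))    | inj₂ (inj₁ (_ , i′))     = ⊥-elim (<⇒≢ b<c (trans (sym i′) (trans (sym same) i)))

module K23Colouring (n : ℕ) where
  open Neighbourhood n public

  δ : Labelling
  δ = label flipRule n

  specialVertex : ℕ → ℕ
  specialVertex v = inheritedVertex (parentFace n v) (parentFace n (apex (parentFace n v)))

  Special : ℕ → ℕ → Set
  Special x v = (v ≤ 2 × x ≡ 0) ⊎ (3 ≤ v × (x ≡ apex (parentFace n v) ⊎ x ≡ specialVertex v))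

  special? : ∀ x v → Dec (Special x v)
  special? x v = (v ≤? 2 ×-dec x ≟ 0) ⊎-dec (3 ≤? v ×-dec (x ≟ apex (parentFace n v) ⊎-dec x ≟ specialVertex v))

  lowerColour : ℕ → ℕ → Bool
  lowerColour x v = if does (special? x v) then δ v else not (δ v)

  lowerColour-special : ∀ {x v} → Special x v → lowerColour x v ≡ δ v
  lowerColour-special {x} {v} sx rewrite dec-true (special? x v) sx = refl

  lowerColour-nonSpecial : ∀ {x v} → ¬ Special x v → lowerColour x v ≡ not (δ v)
  lowerColour-nonSpecial {x} {v} ¬sx rewrite dec-false (special? x v) ¬sx = refl

  special-lowerColour : ∀ {x v} → lowerColour x v ≡ δ v → Special x v
  special-lowerColour {x} {v} c with special? x v
  ... | yes sx  = sx
  ... | no ¬sx  = ⊥-elim (not-¬ refl (trans (sym c) (lowerColour-nonSpecial ¬sx)))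

  sameColour-special : ∀ {x y v} → lowerColour x v ≡ lowerColour y v → Special x v → Special y v
  sameColour-special c sx = special-lowerColour (trans (sym c) (lowerColour-special sx))

  special-pair : ∀ v → ∃[ p ] ∃[ q ] ∀ {x} → Special x v → x ≡ p ⊎ x ≡ q
  special-pair v with v ≤? 2
  ... | yes v≤2 = 0 , 0 , λ
    { (inj₁ (_ , x≡0)) → inj₁ x≡0 ; (inj₂ (3≤v , _)) → ⊥-elim (<⇒≱ (s≤s v≤2) 3≤v) }
  ... | no v≰2  = apex (parentFace n v) , specialVertex v , λ
    { (inj₁ (v≤2 , _)) → ⊥-elim (v≰2 v≤2) ; (inj₂ (_ , x∈)) → x∈ }

  specialVertex-base : ∀ v →
    specialVertex v ≡ proj₁ (parentFace n v) ⊎ specialVertex v ≡ proj₁ (proj₂ (parentFace n v))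
  specialVertex-base v = inheritedVertex-base (parentFace n v) (parentFace n (apex (parentFace n v)))

  specialVertex<apex : ∀ {v} → 3 ≤ v → v < N n → specialVertex v < apex (parentFace n v)
  specialVertex<apex {v} 3≤v v<N with proj₁ (parentFace-shape 3≤v v<N) | specialVertex-base v
  ... | a<b , b<c , _ | inj₁ s≡a = subst (_< apex (parentFace n v)) (sym s≡a) (<-trans a<b b<c)
  ... | a<b , b<c , _ | inj₂ s≡b = subst (_< apex (parentFace n v)) (sym s≡b) b<c

  nonSpecial-lower-unique : ∀ {v} → AtMostOne (λ x → Lower x v × ¬ Special x v)
  nonSpecial-lower-unique {v} (xv , ¬sx) (yv , ¬sy) with v ≤? 2
  ... | yes v≤2 = trans (is1 xv ¬sx) (sym (is1 yv ¬sy))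
    where
    is1 : ∀ {x} → Lower x v → ¬ Special x v → x ≡ 1
    is1 xv ¬sx with lower-initial xv v≤2
    ... | inj₁ x≡0 = ⊥-elim (¬sx (inj₁ (v≤2 , x≡0)))
    ... | inj₂ x≡1 = x≡1
  ... | no v≰2 = atMostOne-pair-≢ (specialVertex-base v) (base xv ¬sx) (base yv ¬sy)
    where
    3≤v : 3 ≤ v
    3≤v = ≰⇒> v≰2
    base : ∀ {x} → Lower x v → ¬ Special x v →
           (x ≡ proj₁ (parentFace n v) ⊎ x ≡ proj₁ (proj₂ (parentFace n v))) × x ≢ specialVertex v
    base xv ¬sx = ∈▵-≢apex _ (proj₂ (lower-parentFace 3≤v xv)) (λ x≡p → ¬sx (inj₂ (3≤v , inj₁ x≡p))) ,
                  λ x≡s → ¬sx (inj₂ (3≤v , inj₂ x≡s))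

  lower-sameColour-atMostTwo : ∀ {v c} → AtMostTwo (λ x → Lower x v × lowerColour x v ≡ c)
  lower-sameColour-atMostTwo {v} {x = x} (xv , cx) (yv , cy) (zv , cz) with special? x v
  ... | yes sx = let (p , q , pair) = special-pair v in
    atMostTwo-pair p q (pair sx) (pair (sameColour-special (trans cx (sym cy)) sx))
                                 (pair (sameColour-special (trans cx (sym cz)) sx))
  ... | no ¬sx = inj₁ (nonSpecial-lower-unique (xv , ¬sx) (yv , ¬sx ∘ sameColour-special (trans cy (sym cx))))

  lower-sameColour-special : ∀ {x y v} → Lower x v → Lower y v → x ≢ y →
                             lowerColour x v ≡ lowerColour y v → Special x v × Special y v
  lower-sameColour-special {x} {y} {v} xv yv x≢y c with special? x v
  ... | yes sx = sx , sameColour-special c sx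
  ... | no ¬sx = ⊥-elim (x≢y (nonSpecial-lower-unique (xv , ¬sx) (yv , ¬sx ∘ sameColour-special (sym c))))

  IsSpecialChild : ℕ → ℕ → ℕ → Set
  IsSpecialChild x y z = 3 ≤ z × z < N n × y ≡ apex (parentFace n z) × x ≡ specialVertex z

  lower-sameColour-specialChild : ∀ {x y z} → x < y → Lower x z → Lower y z →
                                  lowerColour x z ≡ lowerColour y z → IsSpecialChild x y z
  lower-sameColour-specialChild {x} {y} {z} x<y xz yz c with lower-sameColour-special xz yz (<⇒≢ x<y) c
  ... | inj₁ (_ , refl)          , inj₁ (_ , refl)  = ⊥-elim (<-irrefl refl x<y)
  ... | inj₁ (z≤2 , _)           , inj₂ (3≤z , _)   = ⊥-elim (<⇒≱ (s≤s z≤2) 3≤z)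
  ... | inj₂ (3≤z , _)           , inj₁ (z≤2 , _)   = ⊥-elim (<⇒≱ (s≤s z≤2) 3≤z)
  ... | inj₂ (3≤z , x∈)          , inj₂ (_ , y∈)    = 3≤z , z<N , pick x∈ y∈
    where
    z<N : z < N n
    z<N = proj₁ (lower-parentFace 3≤z xz)
    s<p : specialVertex z < apex (parentFace n z)
    s<p = specialVertex<apex 3≤z z<N
    pick : x ≡ apex (parentFace n z) ⊎ x ≡ specialVertex z → y ≡ apex (parentFace n z) ⊎ y ≡ specialVertex z →
           y ≡ apex (parentFace n z) × x ≡ specialVertex z
    pick (inj₁ refl) (inj₁ refl) = ⊥-elim (<-irrefl refl x<y)
    pick (inj₁ refl) (inj₂ refl) = ⊥-elim (<-asym x<y s<p)
    pick (inj₂ refl) (inj₁ refl) = refl , refl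
    pick (inj₂ refl) (inj₂ refl) = ⊥-elim (<-irrefl refl x<y)

  specialChild-unique : ∀ {x y z z′} → IsSpecialChild x y z → IsSpecialChild x y z′ → z ≡ z′
  specialChild-unique {x} {y} {z} {z′} (3≤z , z<N , y≡p , x≡s) (3≤z′ , z′<N , y≡p′ , x≡s′) =
    parentFace-injective 3≤z z<N 3≤z′ z′<N
      (sameFace (proj₂ (parentFace-shape 3≤z z<N)) (proj₂ (parentFace-shape 3≤z′ z′<N)))
    where
    y<N : y < N n
    y<N = subst (_< N n) (sym y≡p) (<-trans (apex-parentFace 3≤z z<N) z<N)
    initial-apex : ∀ {w w′} → y ≡ apex (parentFace n w) → parentFace n w ≡ (0 , 1 , 2) →
                   y ≡ apex (parentFace n w′) → ¬ 3 ≤ apex (parentFace n w′)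
    initial-apex y≡p t≡ y≡p′ 3≤p′ =
      <⇒≱ (s≤s (≤-reflexive (trans (sym y≡p′) (trans y≡p (cong apex t≡))))) 3≤p′
    inChildren : ∀ {w} → y ≡ apex (parentFace n w) → x ≡ specialVertex w →
                 parentFace n w ∈ children (parentFace n (apex (parentFace n w))) (apex (parentFace n w)) →
                 parentFace n w ∈ children (parentFace n y) y × inheritedVertex (parentFace n w) (parentFace n y) ≡ x
    inChildren refl refl w∈ = w∈ , refl
    sameFace : IsChild n (parentFace n z) → IsChild n (parentFace n z′) → parentFace n z ≡ parentFace n z′
    sameFace (inj₁ t≡)         (inj₁ t′≡)        = trans t≡ (sym t′≡)
    sameFace (inj₁ t≡)         (inj₂ (3≤p′ , _)) = ⊥-elim (initial-apex {z} {z′} y≡p t≡ y≡p′ 3≤p′)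
    sameFace (inj₂ (3≤p , _))  (inj₁ t′≡)        = ⊥-elim (initial-apex {z′} {z} y≡p′ t′≡ y≡p 3≤p)
    sameFace (inj₂ (3≤p , z∈)) (inj₂ (_ , z′∈))
      with inChildren {z} y≡p x≡s z∈ | inChildren {z′} y≡p′ x≡s′ z′∈
    ... | z∈′ , sz | z′∈′ , sz′ =
      let (a<b , b<c , _) = proj₁ (parentFace-shape (subst (3 ≤_) (sym y≡p) 3≤p) y<N)
      in  inheritedVertex-injective (a<b , b<c) z∈′ z′∈′ (trans sz (sym sz′))

  edgeColour : ℕ → ℕ → Bool
  edgeColour u v = lowerColour (u ⊓ v) (u ⊔ v)

  MonoEdge : Bool → ℕ → ℕ → Set
  MonoEdge b u v = Adjacent u v × edgeColour u v ≡ b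

  monoEdge-lower : ∀ {b u v} → MonoEdge b u v →
                   (Lower u v × lowerColour u v ≡ b) ⊎ (Lower v u × lowerColour v u ≡ b)
  monoEdge-lower (inj₁ uv , c) = let u≤v = <⇒≤ (lower-< uv) in
    inj₁ (uv , trans (cong₂ lowerColour (sym (m≤n⇒m⊓n≡m u≤v)) (sym (m≤n⇒m⊔n≡n u≤v))) c)
  monoEdge-lower (inj₂ vu , c) = let v≤u = <⇒≤ (lower-< vu) in
    inj₂ (vu , trans (cong₂ lowerColour (sym (m≥n⇒m⊓n≡n v≤u)) (sym (m≥n⇒m⊔n≡m v≤u))) c)

  Attachment : Bool → ℕ → ℕ → ℕ → Set
  Attachment b x y z = (Lower z y × lowerColour z y ≡ b) ⊎ (δ z ≡ b × δ z ≡ not (δ y) × IsSpecialChild x y z)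

  attachment : ∀ {b x y z} → x < y → MonoEdge b x z → MonoEdge b y z → Attachment b x y z
  attachment x<y xz yz with monoEdge-lower yz
  ... | inj₂ zy = inj₁ zy
  ... | inj₁ (y<z , cy) with monoEdge-lower xz
  ...   | inj₂ (z<x , _)  = ⊥-elim (<-asym (<-trans (lower-< z<x) x<y) (lower-< y<z))
  ...   | inj₁ (x<z , cx) with lower-sameColour-specialChild x<y x<z y<z (trans cx (sym cy))
  ...     | child@(3≤z , z<N , y≡p , x≡s) = inj₂
    ( trans (sym (lowerColour-special (inj₂ (3≤z , inj₂ x≡s)))) cx
    , trans (label-parentFace flipRule flipRule-local n 3≤z z<N) (cong (not ∘ δ) (sym y≡p))
    , child )

  flipped-vs-lower-pair : ∀ {b y z w w′} → δ z ≡ b → δ z ≡ not (δ y) →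
    Lower w y × lowerColour w y ≡ b → Lower w′ y × lowerColour w′ y ≡ b → w ≢ w′ → ⊥
  flipped-vs-lower-pair δz≡b δz≡¬δy (wy , cw) (w′y , cw′) w≢w′ =
    let (sw , _) = lower-sameColour-special wy w′y w≢w′ (trans cw (sym cw′))
    in  not-¬ refl (trans (sym (lowerColour-special sw)) (trans cw (trans (sym δz≡b) δz≡¬δy)))

  no-three-attachments : ∀ {b x y z₁ z₂ z₃} → x < y → z₁ ≢ z₂ → z₁ ≢ z₃ → z₂ ≢ z₃ →
                         Attachment b x y z₁ → Attachment b x y z₂ → Attachment b x y z₃ → ⊥
  no-three-attachments x<y z₁≢z₂ z₁≢z₃ z₂≢z₃ (inj₁ a₁) (inj₁ a₂) (inj₁ a₃) =
    atMostTwo-distinct lower-sameColour-atMostTwo a₁ a₂ a₃ z₁≢z₂ z₁≢z₃ z₂≢z₃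
  no-three-attachments _ z₁≢z₂ _ _ (inj₂ (_ , _ , c₁)) (inj₂ (_ , _ , c₂)) _ = z₁≢z₂ (specialChild-unique c₁ c₂)
  no-three-attachments _ _ z₁≢z₃ _ (inj₂ (_ , _ , c₁)) _ (inj₂ (_ , _ , c₃)) = z₁≢z₃ (specialChild-unique c₁ c₃)
  no-three-attachments _ _ _ z₂≢z₃ _ (inj₂ (_ , _ , c₂)) (inj₂ (_ , _ , c₃)) = z₂≢z₃ (specialChild-unique c₂ c₃)
  no-three-attachments _ _ _ z₂≢z₃ (inj₂ (δb , δ¬ , _)) (inj₁ a₂) (inj₁ a₃) = flipped-vs-lower-pair δb δ¬ a₂ a₃ z₂≢z₃
  no-three-attachments _ _ z₁≢z₃ _ (inj₁ a₁) (inj₂ (δb , δ¬ , _)) (inj₁ a₃) = flipped-vs-lower-pair δb δ¬ a₁ a₃ z₁≢z₃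
  no-three-attachments _ z₁≢z₂ _ _ (inj₁ a₁) (inj₁ a₂) (inj₂ (δb , δ¬ , _)) = flipped-vs-lower-pair δb δ¬ a₁ a₂ z₁≢z₂

  edgeColour-sym : ∀ u v → edgeColour u v ≡ edgeColour v u
  edgeColour-sym u v = cong₂ lowerColour (⊓-comm u v) (⊔-comm u v)

  no-three-common-monoNeighbours : ∀ {b x y z₁ z₂ z₃} → x ≢ y → z₁ ≢ z₂ → z₁ ≢ z₃ → z₂ ≢ z₃ →
    MonoEdge b x z₁ → MonoEdge b y z₁ → MonoEdge b x z₂ → MonoEdge b y z₂ →
    MonoEdge b x z₃ → MonoEdge b y z₃ → ⊥
  no-three-common-monoNeighbours {x = x} {y} x≢y z₁≢z₂ z₁≢z₃ z₂≢z₃ x₁ y₁ x₂ y₂ x₃ y₃ with <-cmp x y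
  ... | tri< x<y _ _ = no-three-attachments x<y z₁≢z₂ z₁≢z₃ z₂≢z₃
                         (attachment x<y x₁ y₁) (attachment x<y x₂ y₂) (attachment x<y x₃ y₃)
  ... | tri≈ _ x≡y _ = x≢y x≡y
  ... | tri> _ _ y<x = no-three-attachments y<x z₁≢z₂ z₁≢z₃ z₂≢z₃
                         (attachment y<x y₁ x₁) (attachment y<x y₂ x₂) (attachment y<x y₃ x₃)

  no-monoK23 : ∀ {b} (ψ : Fin 5 → ℕ) → Injective _≡_ _≡_ ψ →
               (∀ i j → Adj K23 i j → MonoEdge b (ψ i) (ψ j)) → ⊥
  no-monoK23 ψ ψ-injective edge =
    no-three-common-monoNeighbours (# 0 ≉ # 1) (# 2 ≉ # 3) (# 2 ≉ # 4) (# 3 ≉ # 4)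
      (edge (# 0) (# 2) (inj₁ (here refl)))
      (edge (# 1) (# 2) (inj₁ (there (there (there (here refl))))))
      (edge (# 0) (# 3) (inj₁ (there (here refl))))
      (edge (# 1) (# 3) (inj₁ (there (there (there (there (here refl)))))))
      (edge (# 0) (# 4) (inj₁ (there (there (here refl)))))
      (edge (# 1) (# 4) (inj₁ (there (there (there (there (there (here refl))))))))
    where
    infix 4 _≉_
    _≉_ : ∀ i j {i≢j : False (i Fin.≟ j)} → ψ i ≢ ψ j
    _≉_ = injective-≢ ψ-injective

inducedColouring : ∀ n (c : ℕ → ℕ → Bool) → (∀ u v → c u v ≡ c v u) → SymColoring (Tr n)
inducedColouring n c c-sym = (λ u v → c (toℕ u) (toℕ v)) , λ u v → c-sym (toℕ u) (toℕ v)

Tr↛K23 : ∀ n → NotArrows (Tr n) K23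
Tr↛K23 n arrows =
  let (b , φ , φ-injective , mono) = arrows (inducedColouring n edgeColour edgeColour-sym)
  in  no-monoK23 (toℕ ∘ φ) (φ-injective ∘ toℕ-injective) mono
  where open K23Colouring n

Tr↛Hplus : ∀ n → NotArrows (Tr n) Hplus
Tr↛Hplus n arrows =
  let (b , φ , φ-injective , mono) = arrows (inducedColouring n minColour minColour-sym)
  in  no-monoHplus (toℕ ∘ φ) (φ-injective ∘ toℕ-injective) mono
  where open MinorityColouring n

Tr↛Cycle : ∀ n {k} → 5 ≤ k → NotArrows (Tr n) (Cycle k)
Tr↛Cycle n (s≤s 4≤K) arrows =
  let (b , φ , φ-injective , mono) = arrows (inducedColouring n minColour minColour-sym)
  in  no-monoCycle 4≤K (toℕ ∘ φ) (φ-injective ∘ toℕ-injective) mono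
  where open MinorityColouring n

theorem1p1 : (n : ℕ) → 1 ≤ n →
    ((k : ℕ) → 5 ≤ k → NotArrows (Tr n) (Cycle k))
    × NotArrows (Tr n) Hplus
    × NotArrows (Tr n) K23
theorem1p1 n _ = (λ k → Tr↛Cycle n) , Tr↛Hplus n , Tr↛K23 n
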